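{- Let $(\Sigma,\mathscr R)$ be a Dedukti theory with $\hookrightarrow_{\beta\mathscr R}$ confluent and $\mathscr R$ arity-preserving. If $\Sigma;\Gamma\vdash M:A$ and $A\neq\mathtt{KIND}$, then there is $\Sigma'\subseteq\Sigma$ such that $\Gamma_\pi,\|\Sigma'\|,\|\Gamma\|\vdash_\lambda|M|:\|A\|$ in the simply-typed $\lambda$-calculus.
   Context: Dedukti terms $x\mid c[\vec M]\mid\mathtt{TYPE}\mid\mathtt{KIND}\mid MN\mid\lambda x:A.M\mid\Pi x:A.B$ (constants of fixed arity), signatures of declarations $c[\Delta]:A$, rewrite rules $c[\vec l]\hookrightarrow r$, $\equiv$ generated by $\beta$ and the rules; typing by the rules Empty, Decl ($A:\mathtt{TYPE}$), Cons ($c[\Delta]:A\in\Sigma$, $\Sigma;\Delta\vdash A:s$, arguments $\vec M$ typed sequentially against $\Delta$ give $c[\vec M]:A\{\vec M\}$), Sort ($\mathtt{TYPE}:\mathtt{KIND}$), Var, Conv (modulo $\equiv$, target type of sort $s\in\{\mathtt{TYPE},\mathtt{KIND}\}$), Prod ($A:\mathtt{TYPE}$, $x:A\vdash B:s$ give $\Pi x:A.B:s$), App, Abs ($A:\mathtt{TYPE}$, $x:A\vdash B:s$, $x:A\vdash M:B$ give $\lambda x:A.M:\Pi x:A.B$). A constant is type-level (written $\alpha$) if its declared type has the form $\Pi\vec x:\vec B.\mathtt{TYPE}$, otherwise object-level ($a$); a rule is type-level if its head is. $\mathscr R$ is arity-preserving if every type-level rule has right-hand side in $R::=\alpha[\vec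 M]\mid R\,N\mid\lambda x:A.R$. Simple types $\sigma::=*\mid\sigma\to\sigma$; $\Gamma_\pi$ declares $\pi_\sigma:*\to(\sigma\to*)\to*$ for every $\sigma$. Partial maps: $\|\mathtt{TYPE}\|=*$, $\|\alpha[\vec M]\|=*$, $\|\Pi x:A.B\|=\|A\|\to\|B\|$, $\|A\,N\|=\|A\|$, $\|\lambda x:A.B\|=\|B\|$ (undefined otherwise); $|x|=x$, $|c[M_1,\dots,M_n]|=c\,|M_1|\cdots|M_n|$, $|MN|=|M|\,|N|$, $|\lambda x:A.M|=(\lambda z.\lambda x.|M|)\,|A|$ with $z$ fresh, $|\Pi x:A.B|=\pi_{\|A\|}\,|A|\,(\lambda x.|B|)$. On contexts $\|x:A,\Gamma\|=x:\|A\|,\|\Gamma\|$; on signatures $\|c[x_1:A_1,\dots,x_n:A_n]:A\|=c:\|A_1\|\to\cdots\to\|A_n\|\to\|A\|$. -}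

module Defs where

open import Data.Nat using (ℕ; zero; suc; _≡ᵇ_)
open import Data.Fin using (Fin; zero; suc)
open import Data.Bool using (Bool; true; false; if_then_else_)
open import Data.List using (List; []; _∷_; _∷ʳ_; foldl)
open import Data.Vec using (Vec; []; _∷_; lookup)
open import Data.Maybe using (Maybe; just; nothing; _>>=_)
open import Data.Product using (_×_; _,_; ∃)
open import Data.List.Membership.Propositional using (_∈_)
open import Relation.Binary.PropositionalEquality using (_≡_)
open import Relation.Binary.Construct.Closure.ReflexiveTransitive using (Star)
open import Relation.Binary.Construct.Closure.Equivalence using (EqClosure)

-- Dedukti terms (well-scoped de Bruijn syntax; variable 0 = innermost)

data Tm (n : ℕ) : Set where
  var  : Fin n → Tm n
  con  : ℕ → List (Tm n) → Tm n
  TYPE : Tm n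
  KIND : Tm n
  app  : Tm n → Tm n → Tm n
  lam  : Tm n → Tm (suc n) → Tm n
  pi   : Tm n → Tm (suc n) → Tm n

liftR : ∀ {m n} → (Fin m → Fin n) → Fin (suc m) → Fin (suc n)
liftR ρ zero    = zero
liftR ρ (suc i) = suc (ρ i)

mutual
  ren : ∀ {m n} → (Fin m → Fin n) → Tm m → Tm n
  ren ρ (var i)    = var (ρ i)
  ren ρ (con c Ms) = con c (renL ρ Ms)
  ren ρ TYPE       = TYPE
  ren ρ KIND       = KIND
  ren ρ (app M N)  = app (ren ρ M) (ren ρ N)
  ren ρ (lam A M)  = lam (ren ρ A) (ren (liftR ρ) M)
  ren ρ (pi A B)   = pi (ren ρ A) (ren (liftR ρ) B)

  renL : ∀ {m n} → (Fin m → Fin n) → List (Tm m) → List (Tm n)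
  renL ρ []       = []
  renL ρ (M ∷ Ms) = ren ρ M ∷ renL ρ Ms

wk : ∀ {n} → Tm n → Tm (suc n)
wk = ren suc

liftS : ∀ {m n} → (Fin m → Tm n) → Fin (suc m) → Tm (suc n)
liftS σ zero    = var zero
liftS σ (suc i) = wk (σ i)

mutual
  sub : ∀ {m n} → (Fin m → Tm n) → Tm m → Tm n
  sub σ (var i)    = σ i
  sub σ (con c Ms) = con c (subL σ Ms)
  sub σ TYPE       = TYPE
  sub σ KIND       = KIND
  sub σ (app M N)  = app (sub σ M) (sub σ N)
  sub σ (lam A M)  = lam (sub σ A) (sub (liftS σ) M)
  sub σ (pi A B)   = pi (sub σ A) (sub (liftS σ) B)

  subL : ∀ {m n} → (Fin m → Tm n) → List (Tm m) → List (Tm n)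
  subL σ []       = []
  subL σ (M ∷ Ms) = sub σ M ∷ subL σ Ms

_▹_ : ∀ {m n} → (Fin m → Tm n) → Tm n → Fin (suc m) → Tm n
(σ ▹ N) zero    = N
(σ ▹ N) (suc i) = σ i

_[_]₀ : ∀ {n} → Tm (suc n) → Tm n → Tm n
M [ N ]₀ = sub (var ▹ N) M

data Ctx : ℕ → Set where
  ∅   : Ctx zero
  _,_ : ∀ {n} → Ctx n → Tm n → Ctx (suc n)

lookupTy : ∀ {n} → Ctx n → Fin n → Tm n
lookupTy (Γ , A) zero    = wk A
lookupTy (Γ , A) (suc i) = wk (lookupTy Γ i)

record Decl : Set where
  constructor decl
  field
    name  : ℕ
    arity : ℕ
    ctx   : Ctx arity
    ty    : Tm arity

Sig : Set
Sig = List Decl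

-- a rewrite rule c[l₁,…,lₖ] ↪ r with 'nvars' pattern variables
record Rule : Set where
  constructor rule
  field
    nvars : ℕ
    head  : ℕ
    lhs   : List (Tm nvars)
    rhs   : Tm nvars

Rules : Set
Rules = List Rule

isTypeLevelTy : ∀ {n} → Tm n → Bool
isTypeLevelTy TYPE     = true
isTypeLevelTy (pi A B) = isTypeLevelTy B
isTypeLevelTy _        = false

lookupDecl : Sig → ℕ → Maybe Decl
lookupDecl []       c = nothing
lookupDecl (d ∷ Sg) c = if Decl.name d ≡ᵇ c then just d else lookupDecl Sg c

isTypeLevelConst : Sig → ℕ → Bool
isTypeLevelConst Sg c with lookupDecl Sg c
... | just d  = isTypeLevelTy (Decl.ty d)
... | nothing = false

data IsR (Sg : Sig) {n : ℕ} : Tm n → Set where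
  rcon : ∀ {c Ms} → isTypeLevelConst Sg c ≡ true → IsR Sg (con c Ms)
  rapp : ∀ {M N} → IsR Sg M → IsR Sg (app M N)
  rlam : ∀ {A M} → IsR Sg M → IsR Sg (lam A M)

ArityPreserving : Sig → Rules → Set
ArityPreserving Sg R = ∀ {r} → r ∈ R →
  isTypeLevelConst Sg (Rule.head r) ≡ true → IsR Sg (Rule.rhs r)

module _ (R : Rules) where
  mutual
    data _⟶_ {n : ℕ} : Tm n → Tm n → Set where
      beta  : ∀ {A M N} → app (lam A M) N ⟶ (M [ N ]₀)
      rew   : ∀ {m c ls r} → rule m c ls r ∈ R → (σ : Fin m → Tm n) →
              con c (subL σ ls) ⟶ sub σ r
      conArg : ∀ {c Ms Ms'} → Ms ⟶L Ms' → con c Ms ⟶ con c Ms'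
      appL  : ∀ {M M' N} → M ⟶ M' → app M N ⟶ app M' N
      appR  : ∀ {M N N'} → N ⟶ N' → app M N ⟶ app M N'
      lamA  : ∀ {A A' M} → A ⟶ A' → lam A M ⟶ lam A' M
      lamM  : ∀ {A M M'} → M ⟶ M' → lam A M ⟶ lam A M'
      piA   : ∀ {A A' B} → A ⟶ A' → pi A B ⟶ pi A' B
      piB   : ∀ {A B B'} → B ⟶ B' → pi A B ⟶ pi A B'

    data _⟶L_ {n : ℕ} : List (Tm n) → List (Tm n) → Set where
      here  : ∀ {M M' Ms} → M ⟶ M' → (M ∷ Ms) ⟶L (M' ∷ Ms)
      there : ∀ {M Ms Ms'} → Ms ⟶L Ms' → (M ∷ Ms) ⟶L (M ∷ Ms')

  _⟶*_ : ∀ {n} → Tm n → Tm n → Set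
  _⟶*_ = Star _⟶_

  _≅_ : ∀ {n} → Tm n → Tm n → Set
  _≅_ = EqClosure _⟶_

Confluent : Rules → Set
Confluent R = ∀ {n} {M N₁ N₂ : Tm n} → _⟶*_ R M N₁ → _⟶*_ R M N₂ →
  ∃ λ P → _⟶*_ R N₁ P × _⟶*_ R N₂ P

data Srt : Set where
  sTYPE sKIND : Srt

⌜_⌝ : ∀ {n} → Srt → Tm n
⌜ sTYPE ⌝ = TYPE
⌜ sKIND ⌝ = KIND

module _ (Sg : Sig) (R : Rules) where
  mutual
    data WfCtx : ∀ {n} → Ctx n → Set where
      empty : WfCtx ∅
      declR : ∀ {n} {Γ : Ctx n} {A} → Typed Γ A TYPE → WfCtx (Γ , A)

    data Typed {n : ℕ} (Γ : Ctx n) : Tm n → Tm n → Set where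
      consR : ∀ {c m} {Δ : Ctx m} {A : Tm m} {Ms} {σ : Fin m → Tm n} {s} →
              WfCtx Γ → decl c m Δ A ∈ Sg → Typed Δ A ⌜ s ⌝ →
              Args Γ Ms Δ σ → Typed Γ (con c Ms) (sub σ A)
      sortR : WfCtx Γ → Typed Γ TYPE KIND
      varR  : ∀ {i} → WfCtx Γ → Typed Γ (var i) (lookupTy Γ i)
      convR : ∀ {M A B s} → Typed Γ M A → Typed Γ B ⌜ s ⌝ →
              _≅_ R A B → Typed Γ M B
      prodR : ∀ {A B s} → Typed Γ A TYPE → Typed (Γ , A) B ⌜ s ⌝ →
              Typed Γ (pi A B) ⌜ s ⌝
      appR  : ∀ {M N A B} → Typed Γ M (pi A B) → Typed Γ N A →
              Typed Γ (app M N) (B [ N ]₀)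
      absR  : ∀ {A B M s} → Typed Γ A TYPE → Typed (Γ , A) B ⌜ s ⌝ →
              Typed (Γ , A) M B → Typed Γ (lam A M) (pi A B)

    data Args {n : ℕ} (Γ : Ctx n) : List (Tm n) → ∀ {m} → Ctx m →
              (Fin m → Tm n) → Set where
      nil  : Args Γ [] ∅ (λ ())
      snoc : ∀ {m Ms N} {Δ : Ctx m} {B : Tm m} {σ} →
             Args Γ Ms Δ σ → Typed Γ N (sub σ B) →
             Args Γ (Ms ∷ʳ N) (Δ , B) (σ ▹ N)

data STy : Set where
  ⋆   : STy
  _⇒_ : STy → STy → STy
infixr 5 _⇒_

data SConst : Set where
  πc  : STy → SConst
  cst : ℕ → SConst

data STm (n : ℕ) : Set where
  var   : Fin n → STm n
  const : SConst → STm n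
  app   : STm n → STm n → STm n
  lam   : STm (suc n) → STm n

sren : ∀ {m n} → (Fin m → Fin n) → STm m → STm n
sren ρ (var i)   = var (ρ i)
sren ρ (const k) = const k
sren ρ (app t u) = app (sren ρ t) (sren ρ u)
sren ρ (lam t)   = lam (sren (liftR ρ) t)

SSig : Set
SSig = List (ℕ × STy)

-- Γ_π, Θ, Γ ⊢λ t : τ   (variable 0 of t is the head of the vector Γ)
data STyped (Θ : SSig) {n : ℕ} (Γ : Vec STy n) : STm n → STy → Set where
  svar : ∀ {i} → STyped Θ Γ (var i) (lookup Γ i)
  spi  : ∀ {σ} → STyped Θ Γ (const (πc σ)) (⋆ ⇒ (σ ⇒ ⋆) ⇒ ⋆)
  scst : ∀ {c τ} → (c , τ) ∈ Θ → STyped Θ Γ (const (cst c)) τ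
  sapp : ∀ {t u σ τ} → STyped Θ Γ t (σ ⇒ τ) → STyped Θ Γ u σ →
         STyped Θ Γ (app t u) τ
  slam : ∀ {t σ τ} → STyped Θ (σ ∷ Γ) t τ → STyped Θ Γ (lam t) (σ ⇒ τ)

module _ (Sg : Sig) where
  ‖_‖ : ∀ {n} → Tm n → Maybe STy
  ‖ TYPE ‖     = just ⋆
  ‖ con c Ms ‖ = if isTypeLevelConst Sg c then just ⋆ else nothing
  ‖ pi A B ‖   = ‖ A ‖ >>= λ a → ‖ B ‖ >>= λ b → just (a ⇒ b)
  ‖ app A N ‖  = ‖ A ‖
  ‖ lam A B ‖  = ‖ B ‖
  ‖ var _ ‖    = nothing
  ‖ KIND ‖     = nothing

  mutual
    ∣_∣ : ∀ {n} → Tm n → Maybe (STm n)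
    ∣ var i ∣    = just (var i)
    ∣ con c Ms ∣ = ∣ Ms ∣L >>= λ ts → just (foldl app (const (cst c)) ts)
    ∣ TYPE ∣     = nothing
    ∣ KIND ∣     = nothing
    ∣ app M N ∣  = ∣ M ∣ >>= λ t → ∣ N ∣ >>= λ u → just (app t u)
    -- |λx:A.M| = (λz.λx.|M|) |A|, z fresh
    ∣ lam A M ∣  = ∣ A ∣ >>= λ a → ∣ M ∣ >>= λ t →
                     just (app (lam (lam (sren (liftR suc) t))) a)
    ∣ pi A B ∣   = ‖ A ‖ >>= λ σ → ∣ A ∣ >>= λ a → ∣ B ∣ >>= λ b →
                     just (app (app (const (πc σ)) a) (lam b))

    ∣_∣L : ∀ {n} → List (Tm n) → Maybe (List (STm n))
    ∣ [] ∣L     = just []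
    ∣ M ∷ Ms ∣L = ∣ M ∣ >>= λ t → ∣ Ms ∣L >>= λ ts → just (t ∷ ts)

  -- ‖x:A, Γ‖ = x:‖A‖, ‖Γ‖   (innermost variable at the head of the vector)
  ‖_‖ctx : ∀ {n} → Ctx n → Maybe (Vec STy n)
  ‖ ∅ ‖ctx     = just []
  ‖ Γ , A ‖ctx = ‖ Γ ‖ctx >>= λ g → ‖ A ‖ >>= λ a → just (a ∷ g)

  -- ‖A₁‖ → ⋯ → ‖Aₖ‖ → τ  for Δ = x₁:A₁,…,xₖ:Aₖ
  arrows : ∀ {m} → Ctx m → STy → Maybe STy
  arrows ∅       τ = just τ
  arrows (Δ , B) τ = ‖ B ‖ >>= λ b → arrows Δ (b ⇒ τ)

  ‖_‖decl : Decl → Maybe (ℕ × STy)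
  ‖ decl c m Δ A ‖decl = ‖ A ‖ >>= λ a → arrows Δ a >>= λ τ → just (c , τ)

  ‖_‖sig : Sig → Maybe SSig
  ‖ [] ‖sig      = just []
  ‖ d ∷ Sg' ‖sig = ‖ d ‖decl >>= λ x → ‖ Sg' ‖sig >>= λ xs → just (x ∷ xs)

module Submission where

-- Induction on the derivation of Γ ⊢ M : A, classifying the judgement: either A = KIND and M is a
-- kind Πx⃗.TYPE, or A has a head (TYPE for kinds, a type-level constant for types), M is a type
-- family when A is a kind, and |M| has simple type ‖A‖ under ‖Γ‖. Heads and ‖·‖ only inspect the
-- spine of a term, so they survive substitution and, because type-level rules rewrite to type-level
-- terms, βR-reduction; by confluence they are invariant under conversion, which handles the Conv
-- rule and separates KIND from every headed type. Tracking heads instead of the typability of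
-- types avoids a substitution lemma for Dedukti. Σ' keeps the declarations whose translation is
-- defined.

open import Data.Bool using (true; false; T; if_then_else_)
open import Data.Empty using (⊥; ⊥-elim)
open import Data.Fin using (Fin; zero; suc)
open import Data.List using (List; []; _∷_; map; _∷ʳ_; foldl; filterᵇ; mapMaybe)
open import Data.List.Membership.Propositional using (_∈_)
open import Data.List.Membership.Propositional.Properties using (∈-map⁺)
open import Data.List.Properties using (foldl-∷ʳ)
open import Data.List.Relation.Binary.Subset.Propositional using (_⊆_)
open import Data.List.Relation.Binary.Subset.Propositional.Properties using (filter-⊆)
open import Data.List.Relation.Unary.All as All using ()
open import Data.List.Relation.Unary.AllPairs using (_∷_)
open import Data.List.Relation.Unary.Any using (here; there)
open import Data.List.Relation.Unary.Any.Properties using (gmap; mapMaybe⁺)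
open import Data.List.Relation.Unary.Unique.Propositional using (Unique)
open import Data.Maybe using (Maybe; just; nothing; _>>=_; is-just)
open import Data.Maybe.Properties using (just-injective)
open import Data.Maybe.Relation.Unary.Any as MaybeAny using ()
open import Data.Nat using (ℕ; _≡ᵇ_)
open import Data.Nat.Properties using (≡ᵇ⇒≡; ≡⇒≡ᵇ)
open import Data.Product using (Σ-syntax; ∃; ∃₂; _×_; _,_; proj₁; proj₂)
open import Data.Unit using (tt)
open import Data.Vec using (Vec; []; _∷_; lookup)
open import Function using (_∘_)
open import Relation.Binary.PropositionalEquality using (_≡_; _≢_; refl; sym; trans; cong; subst)
open import Relation.Binary.Construct.Closure.Equivalence using (EqClosure; symmetric)
open import Relation.Binary.Construct.Closure.ReflexiveTransitive using (Star; ε; _◅_; _◅◅_)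
open import Relation.Binary.Construct.Closure.Symmetric using (fwd; bwd)
open import Relation.Binary.Rewriting as Rewriting using (conf⇒nf)
open import Relation.Nullary using (¬_)
open import Defs hiding (‖_‖; ∣_∣; ∣_∣L; ‖_‖ctx; ‖_‖decl; ‖_‖sig; arrows; _⟶_; _⟶*_; _≅_)

>>=-just⁻ : ∀ {A B : Set} (m : Maybe A) {f : A → Maybe B} {y} →
            (m >>= f) ≡ just y → ∃ λ x → m ≡ just x × f x ≡ just y
>>=-just⁻ (just x) eq = x , refl , eq

if-just⁻ : ∀ {A : Set} b {x y : A} → (if b then just x else nothing) ≡ just y → b ≡ true × x ≡ y
if-just⁻ true refl = refl , refl

∈-mapMaybe⁺ : ∀ {A B : Set} (f : A → Maybe B) {x y xs} → x ∈ xs → f x ≡ just y → y ∈ mapMaybe f xs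
∈-mapMaybe⁺ f {xs = xs} x∈xs fx≡y =
  mapMaybe⁺ f xs (gmap (λ { refl → subst (MaybeAny.Any _) (sym fx≡y) (MaybeAny.just refl) }) x∈xs)

module _ {A : Set} {_⟶_ : A → A → Set} (confluent : Rewriting.Confluent _⟶_) where

  church-rosser : ∀ {x y} → EqClosure _⟶_ x y → ∃ λ z → Star _⟶_ x z × Star _⟶_ y z
  church-rosser ε = _ , ε , ε
  church-rosser (fwd x⟶x′ ◅ x′≅y) with church-rosser x′≅y
  ... | z , x′↠z , y↠z = z , x⟶x′ ◅ x′↠z , y↠z
  church-rosser (bwd x′⟶x ◅ x′≅y) with church-rosser x′≅y
  ... | z , x′↠z , y↠z with confluent (x′⟶x ◅ ε) x′↠z
  ... | w , x↠w , z↠w = w , x↠w , y↠z ◅◅ z↠w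

STyped-ren : ∀ {Θ m n} {Γ : Vec STy m} {Δ : Vec STy n} {ρ : Fin m → Fin n} →
             (∀ i → lookup Δ (ρ i) ≡ lookup Γ i) →
             ∀ {t τ} → STyped Θ Γ t τ → STyped Θ Δ (sren ρ t) τ
STyped-ren {Θ} {ρ = ρ} ρ-ok (svar {i}) = subst (STyped Θ _ (var (ρ i))) (ρ-ok i) svar
STyped-ren ρ-ok spi = spi
STyped-ren ρ-ok (scst c∈Θ) = scst c∈Θ
STyped-ren ρ-ok (sapp ⊢t ⊢u) = sapp (STyped-ren ρ-ok ⊢t) (STyped-ren ρ-ok ⊢u)
STyped-ren ρ-ok (slam ⊢t) = slam (STyped-ren (λ { zero → refl ; (suc i) → ρ-ok i }) ⊢t)

lookupDecl-∈ : ∀ {Sg d} → Unique (map Decl.name Sg) → d ∈ Sg → lookupDecl Sg (Decl.name d) ≡ just d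
lookupDecl-∈ {d ∷ Sg} {d′} (fresh ∷ unique) d′∈ with Decl.name d ≡ᵇ Decl.name d′ in eq | d′∈
... | true  | here refl = refl
... | true  | there d′∈Sg =
  ⊥-elim (All.lookup fresh (∈-map⁺ Decl.name d′∈Sg) (≡ᵇ⇒≡ _ _ (subst T (sym eq) tt)))
... | false | here refl = ⊥-elim (subst T eq (≡⇒≡ᵇ (Decl.name d) _ refl))
... | false | there d′∈Sg = lookupDecl-∈ unique d′∈Sg

KIND-untyped : ∀ {Sg R n} {Γ : Ctx n} {A} → ¬ Typed Sg R Γ KIND A
KIND-untyped (convR ⊢KIND _ _) = KIND-untyped ⊢KIND

data Head : Set where
  sort tyCon : Head

module Erasure (Sg : Sig) where

  ‖_‖ : ∀ {n} → Tm n → Maybe STy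
  ‖_‖ = Defs.‖_‖ Sg

  ∣_∣ : ∀ {n} → Tm n → Maybe (STm n)
  ∣_∣ = Defs.∣_∣ Sg

  ∣_∣L : ∀ {n} → List (Tm n) → Maybe (List (STm n))
  ∣_∣L = Defs.∣_∣L Sg

  ‖_‖ctx : ∀ {n} → Ctx n → Maybe (Vec STy n)
  ‖_‖ctx = Defs.‖_‖ctx Sg

  arrows : ∀ {m} → Ctx m → STy → Maybe STy
  arrows = Defs.arrows Sg

  ‖_‖decl : Decl → Maybe (ℕ × STy)
  ‖_‖decl = Defs.‖_‖decl Sg

  ‖_‖sig : Sig → Maybe SSig
  ‖_‖sig = Defs.‖_‖sig Sg

  -- Kinds Πx⃗.TYPE are headed by sort, types α[M⃗] N⃗ (possibly under λs and Πs) by tyCon.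
  head : ∀ {n} → Tm n → Maybe Head
  head TYPE       = just sort
  head (con c Ms) = if isTypeLevelConst Sg c then just tyCon else nothing
  head (app A N)  = head A
  head (lam A B)  = head B
  head (pi A B)   = head B
  head (var _)    = nothing
  head KIND       = nothing

  Shaped : ∀ {n} → Head → Tm n → Set
  Shaped h M = ∃ λ τ → ‖ M ‖ ≡ just τ × head M ≡ just h

  kind-head : ∀ {n} {K : Tm n} → isTypeLevelTy K ≡ true → head K ≡ just sort
  kind-head {K = TYPE}   _  = refl
  kind-head {K = pi A B} tl = kind-head {K = B} tl

  type-level-con : ∀ {n c} {Ms : List (Tm n)} → isTypeLevelConst Sg c ≡ true →
                   ‖ con c Ms ‖ ≡ just ⋆ × head (con c Ms) ≡ just tyCon
  type-level-con tl rewrite tl = refl , refl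

  ‖pi‖ : ∀ {n} {A : Tm n} {B a b} → ‖ A ‖ ≡ just a → ‖ B ‖ ≡ just b → ‖ pi A B ‖ ≡ just (a ⇒ b)
  ‖pi‖ ‖A‖≡ ‖B‖≡ rewrite ‖A‖≡ | ‖B‖≡ = refl

  ‖pi‖⁻ : ∀ {n} {A : Tm n} {B τ} → ‖ pi A B ‖ ≡ just τ →
          ∃₂ λ a b → ‖ A ‖ ≡ just a × ‖ B ‖ ≡ just b × τ ≡ a ⇒ b
  ‖pi‖⁻ {A = A} {B} eq with >>=-just⁻ ‖ A ‖ eq
  ... | a , ‖A‖≡ , eq′ with >>=-just⁻ ‖ B ‖ eq′
  ... | b , ‖B‖≡ , refl = a , b , ‖A‖≡ , ‖B‖≡ , refl

  ‖,‖ctx : ∀ {n} {Γ : Ctx n} {A Γs a} → ‖ Γ ‖ctx ≡ just Γs → ‖ A ‖ ≡ just a → ‖ Γ , A ‖ctx ≡ just (a ∷ Γs)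
  ‖,‖ctx ‖Γ‖≡ ‖A‖≡ rewrite ‖Γ‖≡ | ‖A‖≡ = refl

  ‖decl‖ : ∀ {c m} {Δ : Ctx m} {A a ρ} → ‖ A ‖ ≡ just a → arrows Δ a ≡ just ρ →
           ‖ decl c m Δ A ‖decl ≡ just (c , ρ)
  ‖decl‖ ‖A‖≡ arrows≡ rewrite ‖A‖≡ | arrows≡ = refl

  ∣app∣ : ∀ {n} {M N : Tm n} {t u} → ∣ M ∣ ≡ just t → ∣ N ∣ ≡ just u → ∣ app M N ∣ ≡ just (app t u)
  ∣app∣ ∣M∣≡ ∣N∣≡ rewrite ∣M∣≡ | ∣N∣≡ = refl

  ∣lam∣ : ∀ {n} {A : Tm n} {M a t} → ∣ A ∣ ≡ just a → ∣ M ∣ ≡ just t →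
          ∣ lam A M ∣ ≡ just (app (lam (lam (sren (liftR suc) t))) a)
  ∣lam∣ ∣A∣≡ ∣M∣≡ rewrite ∣A∣≡ | ∣M∣≡ = refl

  ∣pi∣ : ∀ {n} {A : Tm n} {B σ a b} → ‖ A ‖ ≡ just σ → ∣ A ∣ ≡ just a → ∣ B ∣ ≡ just b →
         ∣ pi A B ∣ ≡ just (app (app (const (πc σ)) a) (lam b))
  ∣pi∣ ‖A‖≡ ∣A∣≡ ∣B∣≡ rewrite ‖A‖≡ | ∣A∣≡ | ∣B∣≡ = refl

  ∣con∣ : ∀ {n c} {Ms : List (Tm n)} {ts} → ∣ Ms ∣L ≡ just ts →
          ∣ con c Ms ∣ ≡ just (foldl app (const (cst c)) ts)
  ∣con∣ ∣Ms∣≡ rewrite ∣Ms∣≡ = refl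

  ∣∷ʳ∣L : ∀ {n} (Ms : List (Tm n)) {N ts u} → ∣ Ms ∣L ≡ just ts → ∣ N ∣ ≡ just u →
          ∣ Ms ∷ʳ N ∣L ≡ just (ts ∷ʳ u)
  ∣∷ʳ∣L [] refl ∣N∣≡ rewrite ∣N∣≡ = refl
  ∣∷ʳ∣L (M ∷ Ms) eq ∣N∣≡ with >>=-just⁻ ∣ M ∣ eq
  ... | t , ∣M∣≡ , eq′ with >>=-just⁻ ∣ Ms ∣L eq′
  ... | ts , ∣Ms∣≡ , refl rewrite ∣M∣≡ = cong (_>>= λ ts → just (t ∷ ts)) (∣∷ʳ∣L Ms ∣Ms∣≡ ∣N∣≡)

  ‖‖-sub : ∀ {m n} (σ : Fin m → Tm n) M {τ} → ‖ M ‖ ≡ just τ → ‖ sub σ M ‖ ≡ just τ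
  ‖‖-sub σ TYPE       ‖M‖≡ = ‖M‖≡
  ‖‖-sub σ (con c Ms) ‖M‖≡ = ‖M‖≡
  ‖‖-sub σ (app A N)  ‖M‖≡ = ‖‖-sub σ A ‖M‖≡
  ‖‖-sub σ (lam A B)  ‖M‖≡ = ‖‖-sub (liftS σ) B ‖M‖≡
  ‖‖-sub σ (pi A B)   ‖M‖≡ with ‖pi‖⁻ {A = A} {B} ‖M‖≡
  ... | _ , _ , ‖A‖≡ , ‖B‖≡ , refl = ‖pi‖ {A = sub σ A} {sub (liftS σ) B} (‖‖-sub σ A ‖A‖≡) (‖‖-sub (liftS σ) B ‖B‖≡)

  ‖‖-ren : ∀ {m n} (ρ : Fin m → Fin n) M {τ} → ‖ M ‖ ≡ just τ → ‖ ren ρ M ‖ ≡ just τ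
  ‖‖-ren ρ TYPE       ‖M‖≡ = ‖M‖≡
  ‖‖-ren ρ (con c Ms) ‖M‖≡ = ‖M‖≡
  ‖‖-ren ρ (app A N)  ‖M‖≡ = ‖‖-ren ρ A ‖M‖≡
  ‖‖-ren ρ (lam A B)  ‖M‖≡ = ‖‖-ren (liftR ρ) B ‖M‖≡
  ‖‖-ren ρ (pi A B)   ‖M‖≡ with ‖pi‖⁻ {A = A} {B} ‖M‖≡
  ... | _ , _ , ‖A‖≡ , ‖B‖≡ , refl = ‖pi‖ {A = ren ρ A} {ren (liftR ρ) B} (‖‖-ren ρ A ‖A‖≡) (‖‖-ren (liftR ρ) B ‖B‖≡)

  head-sub : ∀ {m n} (σ : Fin m → Tm n) M {h} → head M ≡ just h → head (sub σ M) ≡ just h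
  head-sub σ TYPE       hM = hM
  head-sub σ (con c Ms) hM = hM
  head-sub σ (app A N)  hM = head-sub σ A hM
  head-sub σ (lam A B)  hM = head-sub (liftS σ) B hM
  head-sub σ (pi A B)   hM = head-sub (liftS σ) B hM

  head-ren : ∀ {m n} (ρ : Fin m → Fin n) M {h} → head M ≡ just h → head (ren ρ M) ≡ just h
  head-ren ρ TYPE       hM = hM
  head-ren ρ (con c Ms) hM = hM
  head-ren ρ (app A N)  hM = head-ren ρ A hM
  head-ren ρ (lam A B)  hM = head-ren (liftR ρ) B hM
  head-ren ρ (pi A B)   hM = head-ren (liftR ρ) B hM

  ‖lookupTy‖ : ∀ {n} (Γ : Ctx n) {Γs} → ‖ Γ ‖ctx ≡ just Γs → ∀ i → ‖ lookupTy Γ i ‖ ≡ just (lookup Γs i)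
  ‖lookupTy‖ (Γ , A) eq i with >>=-just⁻ ‖ Γ ‖ctx eq
  ... | Γs , ‖Γ‖≡ , eq′ with >>=-just⁻ ‖ A ‖ eq′
  ‖lookupTy‖ (Γ , A) eq zero    | _ | _ , ‖A‖≡ , refl = ‖‖-ren suc A ‖A‖≡
  ‖lookupTy‖ (Γ , A) eq (suc i) | _ , ‖Γ‖≡ , _ | _ , _ , refl = ‖‖-ren suc (lookupTy Γ i) (‖lookupTy‖ Γ ‖Γ‖≡ i)

  arrows-defined : ∀ {m} (Δ : Ctx m) {Δs} → ‖ Δ ‖ctx ≡ just Δs → ∀ τ → ∃ λ ρ → arrows Δ τ ≡ just ρ
  arrows-defined ∅       _  τ = τ , refl
  arrows-defined (Δ , B) eq τ with >>=-just⁻ ‖ Δ ‖ctx eq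
  ... | _ , ‖Δ‖≡ , eq′ with >>=-just⁻ ‖ B ‖ eq′
  ... | b , ‖B‖≡ , _ rewrite ‖B‖≡ = arrows-defined Δ ‖Δ‖≡ (b ⇒ τ)

  translatable : Sig → Sig
  translatable = filterᵇ (is-just ∘ ‖_‖decl)

  ‖translatable‖sig : ∀ ds → ‖ translatable ds ‖sig ≡ just (mapMaybe ‖_‖decl ds)
  ‖translatable‖sig []       = refl
  ‖translatable‖sig (d ∷ ds) with ‖ d ‖decl in ‖d‖≡
  ... | just _  rewrite ‖d‖≡ | ‖translatable‖sig ds = refl
  ... | nothing = ‖translatable‖sig ds

  Θ : SSig
  Θ = mapMaybe ‖_‖decl Sg

  record TranslatedCtx {n} (Γ : Ctx n) : Set where
    field
      types      : Vec STy n
      types≡     : ‖ Γ ‖ctx ≡ just types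
      typeHeaded : ∀ i → head (lookupTy Γ i) ≡ just tyCon

  extend : ∀ {n} {Γ : Ctx n} {A} → TranslatedCtx Γ → Shaped tyCon A → TranslatedCtx (Γ , A)
  extend {Γ = Γ} {A} C (a , ‖A‖≡ , hA) = record
    { types      = a ∷ types
    ; types≡     = ‖,‖ctx {Γ = Γ} {A} types≡ ‖A‖≡
    ; typeHeaded = λ { zero → head-ren suc A hA ; (suc i) → head-ren suc (lookupTy Γ i) (typeHeaded i) }
    }
    where open TranslatedCtx C

  record Translates {n} (Γ : Ctx n) (M A : Tm n) : Set where
    constructor translates
    field
      {type} : STy
      type≡  : ‖ A ‖ ≡ just type
      {term} : STm n
      term≡  : ∣ M ∣ ≡ just term
      typed  : ∀ {Γs} → ‖ Γ ‖ctx ≡ just Γs → STyped Θ Γs term type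

  typedAt : ∀ {n} {Γ : Ctx n} {M A τ Γs} (t : Translates Γ M A) →
            ‖ A ‖ ≡ just τ → ‖ Γ ‖ctx ≡ just Γs → STyped Θ Γs (Translates.term t) τ
  typedAt (translates ‖A‖≡ _ ⊢M) ‖A‖≡′ ‖Γ‖≡ =
    subst (STyped Θ _ _) (just-injective (trans (sym ‖A‖≡) ‖A‖≡′)) (⊢M ‖Γ‖≡)

  Translates-var : ∀ {n} {Γ : Ctx n} → TranslatedCtx Γ → ∀ i → Translates Γ (var i) (lookupTy Γ i)
  Translates-var {Γ = Γ} C i = translates (‖lookupTy‖ Γ types≡ i) refl
    λ ‖Γ‖≡ → subst (λ Γs → STyped Θ Γs (var i) (lookup types i)) (just-injective (trans (sym types≡) ‖Γ‖≡)) svar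
    where open TranslatedCtx C

  Translates-pi : ∀ {n} {Γ : Ctx n} {A B a} → ‖ A ‖ ≡ just a →
                  Translates Γ A TYPE → Translates (Γ , A) B TYPE → Translates Γ (pi A B) TYPE
  Translates-pi {Γ = Γ} {A} {B} ‖A‖≡ tA tB = translates refl (∣pi∣ {A = A} {B} ‖A‖≡ (term≡ tA) (term≡ tB))
    λ ‖Γ‖≡ → sapp (sapp spi (typedAt tA refl ‖Γ‖≡)) (slam (typedAt tB refl (‖,‖ctx {Γ = Γ} {A} ‖Γ‖≡ ‖A‖≡)))
    where open Translates

  Translates-app : ∀ {n} {Γ : Ctx n} {M N A B} →
                   Translates Γ M (pi A B) → Translates Γ N A → Translates Γ (app M N) (B [ N ]₀)
  Translates-app {M = M} {N} {A} {B} (translates ‖pi‖≡ ∣M∣≡ ⊢M) tN with ‖pi‖⁻ {A = A} {B} ‖pi‖≡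
  ... | a , b , ‖A‖≡ , ‖B‖≡ , refl =
    translates (‖‖-sub (var ▹ N) B ‖B‖≡) (∣app∣ {M = M} {N} ∣M∣≡ (Translates.term≡ tN))
      λ ‖Γ‖≡ → sapp (⊢M ‖Γ‖≡) (typedAt tN ‖A‖≡ ‖Γ‖≡)

  Translates-lam : ∀ {n} {Γ : Ctx n} {A M B a} → ‖ A ‖ ≡ just a →
                   Translates Γ A TYPE → Translates (Γ , A) M B → Translates Γ (lam A M) (pi A B)
  Translates-lam {Γ = Γ} {A} {M} {B} ‖A‖≡ tA (translates ‖B‖≡ ∣M∣≡ ⊢M) =
    translates (‖pi‖ {A = A} {B} ‖A‖≡ ‖B‖≡) (∣lam∣ {A = A} {M} (Translates.term≡ tA) ∣M∣≡)
      λ ‖Γ‖≡ → sapp (slam (slam (STyped-ren (λ { zero → refl ; (suc i) → refl })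
                                             (⊢M (‖,‖ctx {Γ = Γ} {A} ‖Γ‖≡ ‖A‖≡)))))
                    (typedAt tA refl ‖Γ‖≡)

  TranslatesArgs : ∀ {n} → Ctx n → List (Tm n) → STy → STy → Set
  TranslatesArgs {n} Γ Ms ρ τ = Σ[ ts ∈ List (STm n) ] ∣ Ms ∣L ≡ just ts ×
    (∀ {Γs h} → ‖ Γ ‖ctx ≡ just Γs → STyped Θ Γs h ρ → STyped Θ Γs (foldl app h ts) τ)

  Translates-con : ∀ {n} {Γ : Ctx n} {c m} {Δ : Ctx m} {A a Ms Δs} {σ : Fin m → Tm n} →
                   decl c m Δ A ∈ Sg → ‖ A ‖ ≡ just a → ‖ Δ ‖ctx ≡ just Δs →
                   (∀ {τ ρ} → arrows Δ τ ≡ just ρ → TranslatesArgs Γ Ms ρ τ) →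
                   Translates Γ (con c Ms) (sub σ A)
  Translates-con {Δ = Δ} {A} {a} {Ms} {σ = σ} c∈Sg ‖A‖≡ ‖Δ‖≡ args with arrows-defined Δ ‖Δ‖≡ a
  ... | ρ , arrows≡ with args arrows≡
  ... | ts , ∣Ms∣≡ , ⊢spine = translates (‖‖-sub σ A ‖A‖≡) (∣con∣ {Ms = Ms} ∣Ms∣≡)
    λ ‖Γ‖≡ → ⊢spine ‖Γ‖≡ (scst (∈-mapMaybe⁺ ‖_‖decl c∈Sg (‖decl‖ {Δ = Δ} {A} ‖A‖≡ arrows≡)))

  -- Γ ⊢ M : A at one of the three levels: M a kind, a type family (h = sort) or an object (h = tyCon).
  data Classified {n} (Γ : Ctx n) : Tm n → Tm n → Set where
    kind    : ∀ {K τ} → isTypeLevelTy K ≡ true → ‖ K ‖ ≡ just τ → Classified Γ K KIND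
    element : ∀ {M A h} → head A ≡ just h → (h ≡ sort → Shaped tyCon M) →
              Translates Γ M A → Classified Γ M A

  translation : ∀ {n} {Γ : Ctx n} {M A} → Classified Γ M A → A ≢ KIND → Translates Γ M A
  translation (kind _ _)      A≢KIND = ⊥-elim (A≢KIND refl)
  translation (element _ _ t) _      = t

  ‖‖⇒≢KIND : ∀ {n} {A : Tm n} {τ} → ‖ A ‖ ≡ just τ → A ≢ KIND
  ‖‖⇒≢KIND () refl

  domain≢KIND : ∀ {n} {Γ : Ctx n} {M A B} → Translates Γ M (pi A B) → A ≢ KIND
  domain≢KIND (translates () _ _) refl

  inhabitantHead : Srt → Head
  inhabitantHead sTYPE = tyCon
  inhabitantHead sKIND = sort

  sort-shape : ∀ {n} {Γ : Ctx n} {B s} → Classified Γ B ⌜ s ⌝ → Shaped (inhabitantHead s) B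
  sort-shape {s = sTYPE} (element refl family _) = family refl
  sort-shape {s = sKIND} (kind {K} tl ‖K‖≡)      = _ , ‖K‖≡ , kind-head {K = K} tl
  sort-shape {s = sKIND} (element () _ _)

  kind-of-sort : ∀ {n} {Γ : Ctx n} {K s} → Classified Γ K ⌜ s ⌝ → inhabitantHead s ≡ sort → isTypeLevelTy K ≡ true
  kind-of-sort {s = sKIND} (kind tl _)      _ = tl
  kind-of-sort {s = sKIND} (element () _ _) _
  kind-of-sort {s = sTYPE} _ ()

  module _ (R : Rules) (arity-preserving : ArityPreserving Sg R) where

    _⟶_ : ∀ {n} → Tm n → Tm n → Set
    _⟶_ = Defs._⟶_ R

    _⟶*_ : ∀ {n} → Tm n → Tm n → Set
    _⟶*_ = Star _⟶_

    _≅_ : ∀ {n} → Tm n → Tm n → Set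
    _≅_ = EqClosure _⟶_

    Preserved : ∀ {X : Set} → (∀ {n} → Tm n → Maybe X) → Set
    Preserved f = ∀ {n} {M M′ : Tm n} {x} → M ⟶ M′ → f M ≡ just x → f M′ ≡ just x

    type-level-rhs : ∀ {n} {r : Tm n} → IsR Sg r → ‖ r ‖ ≡ just ⋆ × head r ≡ just tyCon
    type-level-rhs (rcon {Ms = Ms} tl) = type-level-con {Ms = Ms} tl
    type-level-rhs (rapp r)            = type-level-rhs r
    type-level-rhs (rlam r)            = type-level-rhs r

    ‖‖-preserved : Preserved ‖_‖
    ‖‖-preserved (beta {M = M} {N}) ‖M‖≡ = ‖‖-sub (var ▹ N) M ‖M‖≡
    ‖‖-preserved (rew {r = r} r∈R σ) ‖M‖≡ with if-just⁻ _ ‖M‖≡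
    ... | tl , refl = ‖‖-sub σ r (proj₁ (type-level-rhs (arity-preserving r∈R tl)))
    ‖‖-preserved (conArg _)  ‖M‖≡ = ‖M‖≡
    ‖‖-preserved (appL M⟶M′) ‖M‖≡ = ‖‖-preserved M⟶M′ ‖M‖≡
    ‖‖-preserved (appR _)    ‖M‖≡ = ‖M‖≡
    ‖‖-preserved (lamA _)    ‖M‖≡ = ‖M‖≡
    ‖‖-preserved (lamM M⟶M′) ‖M‖≡ = ‖‖-preserved M⟶M′ ‖M‖≡
    ‖‖-preserved (piA {A = A} {A′} {B} A⟶A′) ‖M‖≡ with ‖pi‖⁻ {A = A} {B} ‖M‖≡
    ... | _ , _ , ‖A‖≡ , ‖B‖≡ , refl = ‖pi‖ {A = A′} {B} (‖‖-preserved A⟶A′ ‖A‖≡) ‖B‖≡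
    ‖‖-preserved (piB {A = A} {B} {B′} B⟶B′) ‖M‖≡ with ‖pi‖⁻ {A = A} {B} ‖M‖≡
    ... | _ , _ , ‖A‖≡ , ‖B‖≡ , refl = ‖pi‖ {A = A} {B′} ‖A‖≡ (‖‖-preserved B⟶B′ ‖B‖≡)

    head-preserved : Preserved head
    head-preserved (beta {M = M} {N}) hM = head-sub (var ▹ N) M hM
    head-preserved (rew {r = r} r∈R σ) hM with if-just⁻ _ hM
    ... | tl , refl = head-sub σ r (proj₂ (type-level-rhs (arity-preserving r∈R tl)))
    head-preserved (conArg _)  hM = hM
    head-preserved (appL M⟶M′) hM = head-preserved M⟶M′ hM
    head-preserved (appR _)    hM = hM
    head-preserved (lamA _)    hM = hM
    head-preserved (lamM M⟶M′) hM = head-preserved M⟶M′ hM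
    head-preserved (piA _)     hM = hM
    head-preserved (piB B⟶B′)  hM = head-preserved B⟶B′ hM

    preserved-⟶* : ∀ {X} {f : ∀ {n} → Tm n → Maybe X} → Preserved f →
                   ∀ {n} {M M′ : Tm n} {x} → M ⟶* M′ → f M ≡ just x → f M′ ≡ just x
    preserved-⟶* pf ε          fM = fM
    preserved-⟶* pf (s ◅ M↠M′) fM = preserved-⟶* pf M↠M′ (pf s fM)

    module _ (confluent : Confluent R) where

      conv-invariant : ∀ {X} {f : ∀ {n} → Tm n → Maybe X} → Preserved f →
                       ∀ {n} {M N : Tm n} {x y} → M ≅ N → f M ≡ just x → f N ≡ just y → f N ≡ just x
      conv-invariant pf M≅N fM fN with church-rosser confluent M≅N
      ... | P , M↠P , N↠P =
        trans fN (cong just (just-injective (trans (sym (preserved-⟶* pf N↠P fN)) (preserved-⟶* pf M↠P fM))))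

      KIND-≇ : ∀ {n} {B : Tm n} {h} → KIND ≅ B → head B ≡ just h → ⊥
      KIND-≇ K≅B hB with preserved-⟶* head-preserved (conf⇒nf confluent (λ { (_ , ()) }) (symmetric _ K≅B)) hB
      ... | ()

      Translates-conv : ∀ {n} {Γ : Ctx n} {M A B b} → A ≅ B → ‖ B ‖ ≡ just b → Translates Γ M A → Translates Γ M B
      Translates-conv A≅B ‖B‖≡ (translates ‖A‖≡ ∣M∣≡ ⊢M) =
        translates (conv-invariant ‖‖-preserved A≅B ‖A‖≡ ‖B‖≡) ∣M∣≡ ⊢M

      module Typing (unique : Unique (map Decl.name Sg)) where

        isTypeLevelConst-∈ : ∀ {c m Δ A} → decl c m Δ A ∈ Sg → isTypeLevelConst Sg c ≡ isTypeLevelTy A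
        isTypeLevelConst-∈ d∈Sg rewrite lookupDecl-∈ unique d∈Sg = refl

        mutual
          ctx-translated : ∀ {n} {Γ : Ctx n} → WfCtx Sg R Γ → TranslatedCtx Γ
          ctx-translated empty      = record { types = [] ; types≡ = refl ; typeHeaded = λ () }
          ctx-translated (declR ⊢A) = extend (ctx-of ⊢A) (sort-shape (classify ⊢A))

          ctx-of : ∀ {n} {Γ : Ctx n} {M A} → Typed Sg R Γ M A → TranslatedCtx Γ
          ctx-of (consR w _ _ _) = ctx-translated w
          ctx-of (sortR w)       = ctx-translated w
          ctx-of (varR w)        = ctx-translated w
          ctx-of (convR ⊢M _ _)  = ctx-of ⊢M
          ctx-of (prodR ⊢A _)    = ctx-of ⊢A
          ctx-of (appR ⊢M _)     = ctx-of ⊢M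
          ctx-of (absR ⊢A _ _)   = ctx-of ⊢A

          classify : ∀ {n} {Γ : Ctx n} {M A} → Typed Sg R Γ M A → Classified Γ M A
          classify (consR {c} {A = A} {Ms} {σ} {s} _ c∈Sg ⊢A args) with sort-shape (classify ⊢A)
          ... | _ , ‖A‖≡ , hA = element (head-sub σ A hA) family
                  (Translates-con c∈Sg ‖A‖≡ (TranslatedCtx.types≡ (ctx-of ⊢A)) (translate-args args))
            where
            family : inhabitantHead s ≡ sort → Shaped tyCon (con c Ms)
            family s≡KIND = ⋆ , type-level-con {Ms = Ms} (trans (isTypeLevelConst-∈ c∈Sg) (kind-of-sort (classify ⊢A) s≡KIND))
          classify (sortR _) = kind refl refl
          classify (varR {i} w) = element (typeHeaded i) (λ ()) (Translates-var C i)
            where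
            C : TranslatedCtx _
            C = ctx-translated w
            open TranslatedCtx C
          classify (convR ⊢M ⊢B A≅B) with classify ⊢M | sort-shape (classify ⊢B)
          ... | kind _ _             | _ , _ , hB     = ⊥-elim (KIND-≇ A≅B hB)
          ... | element hA family tM | _ , ‖B‖≡ , hB =
            element (conv-invariant head-preserved A≅B hA hB) family (Translates-conv A≅B ‖B‖≡ tM)
          classify (prodR {A} {B} {sTYPE} ⊢A ⊢B) with sort-shape (classify ⊢A) | sort-shape (classify ⊢B)
          ... | a , ‖A‖≡ , _ | b , ‖B‖≡ , hB =
            element refl (λ _ → a ⇒ b , ‖pi‖ {A = A} {B} ‖A‖≡ ‖B‖≡ , hB)
              (Translates-pi ‖A‖≡ (translation (classify ⊢A) (λ ())) (translation (classify ⊢B) (λ ())))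
          classify (prodR {A} {B} {sKIND} ⊢A ⊢B) with sort-shape (classify ⊢A) | classify ⊢B
          ... | _ , ‖A‖≡ , _ | kind tl ‖B‖≡ = kind tl (‖pi‖ {A = A} {B} ‖A‖≡ ‖B‖≡)
          ... | _            | element () _ _
          classify (appR {N = N} {B = B} ⊢M ⊢N) with classify ⊢M
          ... | element hB family tM =
            element (head-sub (var ▹ N) B hB) family (Translates-app tM (translation (classify ⊢N) (domain≢KIND tM)))
          classify (absR ⊢A ⊢B ⊢M) with sort-shape (classify ⊢A) | classify ⊢M
          ... | _            | kind _ _             = ⊥-elim (KIND-untyped ⊢B)
          ... | _ , ‖A‖≡ , _ | element hB family tM =
            element hB family (Translates-lam ‖A‖≡ (translation (classify ⊢A) (λ ())) tM)

          translate-args : ∀ {n} {Γ : Ctx n} {Ms m} {Δ : Ctx m} {σ τ ρ} →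
                           Args Sg R Γ Ms Δ σ → arrows Δ τ ≡ just ρ → TranslatesArgs Γ Ms ρ τ
          translate-args nil refl = [] , refl , λ _ ⊢h → ⊢h
          translate-args (snoc {Ms = Ms} {B = B} {σ} args ⊢N) arrows≡ with >>=-just⁻ ‖ B ‖ arrows≡
          ... | b , ‖B‖≡ , arrows≡′ with translate-args args arrows≡′
          ... | ts , ∣Ms∣≡ , ⊢spine =
            ts ∷ʳ term , ∣∷ʳ∣L Ms ∣Ms∣≡ term≡ ,
            λ {_} {h} ‖Γ‖≡ ⊢h → subst (λ t → STyped Θ _ t _) (sym (foldl-∷ʳ app h term ts))
                                      (sapp (⊢spine ‖Γ‖≡ ⊢h) (typedAt tN ‖B[σ]‖≡ ‖Γ‖≡))
            where
            ‖B[σ]‖≡ : ‖ sub σ B ‖ ≡ just b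
            ‖B[σ]‖≡ = ‖‖-sub σ B ‖B‖≡
            tN : Translates _ _ (sub σ B)
            tN = translation (classify ⊢N) (‖‖⇒≢KIND ‖B[σ]‖≡)
            open Translates tN

open Defs using (‖_‖; ∣_∣; ‖_‖ctx; ‖_‖sig)

mainTheorem6 : (Sg : Sig) (R : Rules) →
    Unique (map Decl.name Sg) →
    Confluent R → ArityPreserving Sg R →
    ∀ {n} (Γ : Ctx n) (M A : Tm n) →
    Typed Sg R Γ M A → A ≢ KIND →
    Σ[ Sg' ∈ Sig ] Sg' ⊆ Sg ×
      (Σ[ Θ ∈ SSig ] ‖_‖sig Sg Sg' ≡ just Θ ×
        (Σ[ Γs ∈ Vec STy n ] ‖_‖ctx Sg Γ ≡ just Γs ×
          (Σ[ t ∈ STm n ] ∣_∣ Sg M ≡ just t ×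
            (Σ[ τ ∈ STy ] ‖_‖ Sg A ≡ just τ × STyped Θ Γs t τ))))
mainTheorem6 Sg R unique confluent arity-preserving Γ M A ⊢M A≢KIND =
  translatable Sg , filter-⊆ _ Sg , Θ , ‖translatable‖sig Sg ,
  types , types≡ , term , term≡ , type , type≡ , typed types≡
  where
  open Erasure Sg
  open Typing R arity-preserving confluent unique
  open TranslatedCtx (ctx-of ⊢M)
  open Translates (translation (classify ⊢M) A≢KIND)
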